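{- For every institution $\mathcal{I}$, its temporalisation $\mathcal{L}\mathcal{I}$ is an institution, i.e. for every signature morphism $\varphi:\Sigma\to\Sigma'$ of $\mathcal{I}$, every model $M\in|Mod^{\mathcal{L}\mathcal{I}}(\Sigma')|$ and every sentence $\rho\in Sen^{\mathcal{L}\mathcal{I}}(\Sigma)$ we have $Mod^{\mathcal{L}\mathcal{I}}(\varphi)(M)\models_\Sigma\rho$ iff $M\models_{\Sigma'}Sen^{\mathcal{L}\mathcal{I}}(\varphi)(\rho)$.
   Context: An institution $\mathcal{I}=(Sign^{\mathcal{I}},Sen^{\mathcal{I}},Mod^{\mathcal{I}},(\models^{\mathcal{I}}_\Sigma)_{\Sigma})$ consists of a category $Sign^{\mathcal{I}}$ of signatures, a functor $Sen^{\mathcal{I}}:Sign^{\mathcal{I}}\to\mathbf{Set}$, a functor $Mod^{\mathcal{I}}:(Sign^{\mathcal{I}})^{op}\to\mathbf{Cat}$, and relations $\models^{\mathcal{I}}_\Sigma\subseteq|Mod^{\mathcal{I}}(\Sigma)|\times Sen^{\mathcal{I}}(\Sigma)$ such that for every $\varphi:\Sigma\to\Sigma'$, $M\in|Mod^{\mathcal{I}}(\Sigma')|$, $\rho\in Sen^{\mathcal{I}}(\Sigma)$: $Mod^{\mathcal{I}}(\varphi)(M)\models_\Sigma\rho$ iff $M\models_{\Sigma'}Sen^{\mathcal{I}}(\varphi)(\rho)$ (satisfaction condition). A tuple of the same shape not necessarily satisfying this condition is a pre-institution. Temporalisation $\mathcal{L}\mathcal{I}$ of an institution $\mathcal{I}$: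 signatures and signature morphisms are those of $\mathcal{I}$. For a signature $\Sigma$, $Sen^{\mathcal{L}\mathcal{I}}(\Sigma)$ is the smallest set generated by the grammar $\rho::=\psi\mid\neg\rho\mid\rho\wedge\rho\mid X\rho\mid\rho\,U\,\rho$ with $\psi\in Sen^{\mathcal{I}}(\Sigma)$; for $\varphi:\Sigma\to\Sigma'$, $Sen^{\mathcal{L}\mathcal{I}}(\varphi)(\rho)$ is obtained from $\rho$ by replacing every base sentence $\psi\in Sen^{\mathcal{I}}(\Sigma)$ occurring in it by $Sen^{\mathcal{I}}(\varphi)(\psi)$. $Mod^{\mathcal{L}\mathcal{I}}(\Sigma)$ is the discrete category whose objects are triples $M=(\mathbb{N},\mathrm{suc},m)$ with $\mathrm{suc}$ the successor function and $m:\mathbb{N}\to|Mod^{\mathcal{I}}(\Sigma)|$; write $M_n=m(n)$. For $\varphi:\Sigma\to\Sigma'$, $Mod^{\mathcal{L}\mathcal{I}}(\varphi)(\mathbb{N},\mathrm{suc},m)=(\mathbb{N},\mathrm{suc},Mod^{\mathcal{I}}(\varphi)\circ m)$. Satisfaction: $M\models\rho$ iff $M\models^0\rho$, where $M\models^j\psi$ iff $M_j\models^{\mathcal{I}}\psi$ for $\psi\in Sen^{\mathcal{I}}(\Sigma)$; $M\models^j\neg\rho$ iff not $M\models^j\rho$; $M\models^j\rho\wedge\rho'$ iff $M\models^j\rho$ and $M\models^j\rho'$; $M\models^jX\rho$ iff $M\models^{j+1}\rho$; $M\models^j\rho\,U\,\rho'$ iff for some $k\ge j$, $M\models^k\rho'$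 and $M\models^i\rho$ for all $j\le i<k$. -}

module Defs where

open import Level using (Level; _⊔_; suc; zero)
open import Data.Nat using (ℕ) renaming (suc to sucℕ)
open import Data.Nat as ℕ using (_≤_; _<_)
open import Data.Product using (Σ; ∃; _×_; _,_)
open import Relation.Nullary using (¬_)
open import Relation.Binary.PropositionalEquality using (_≡_; refl; sym; trans; cong)
open import Function using (_∘_; id)
open import Function.Bundles using (_⇔_)

record Category (o h : Level) : Set (suc (o ⊔ h)) where
  field
    Obj   : Set o
    Hom   : Obj → Obj → Set h
    idC   : ∀ {A} → Hom A A
    _∘C_  : ∀ {A B C} → Hom B C → Hom A B → Hom A C
    identityˡ : ∀ {A B} (f : Hom A B) → idC ∘C f ≡ f
    identityʳ : ∀ {A B} (f : Hom A B) → f ∘C idC ≡ f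
    assoc : ∀ {A B C D} (f : Hom A B) (g : Hom B C) (h : Hom C D) →
            (h ∘C g) ∘C f ≡ h ∘C (g ∘C f)

record Functor {o₁ h₁ o₂ h₂} (C : Category o₁ h₁) (D : Category o₂ h₂)
       : Set (o₁ ⊔ h₁ ⊔ o₂ ⊔ h₂) where
  private
    module C = Category C
    module D = Category D
  field
    F₀ : C.Obj → D.Obj
    F₁ : ∀ {A B} → C.Hom A B → D.Hom (F₀ A) (F₀ B)
    F-id : ∀ {A} → F₁ (C.idC {A}) ≡ D.idC
    F-∘  : ∀ {A B E} (f : C.Hom A B) (g : C.Hom B E) →
           F₁ (g C.∘C f) ≡ (F₁ g D.∘C F₁ f)

-- Functoriality of Sen is pointwise; the functor laws of Mod itself
-- (Mod(id)=id, Mod(g∘f)=Mod(f)∘Mod(g)) are omitted;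
-- each Mod(φ) is a genuine functor.
record PreInstitution (o h s m mh : Level)
       : Set (suc (o ⊔ h ⊔ s ⊔ m ⊔ mh)) where
  field
    Sign : Category o h
  open Category Sign public using () renaming (Obj to SigObj; Hom to SigHom; idC to sid; _∘C_ to _∘S_)
  field
    Sen     : SigObj → Set s
    Sen₁    : ∀ {Σ₁ Σ₂} → SigHom Σ₁ Σ₂ → Sen Σ₁ → Sen Σ₂
    Sen-id  : ∀ {Σ₁} (ρ : Sen Σ₁) → Sen₁ (sid {Σ₁}) ρ ≡ ρ
    Sen-∘   : ∀ {Σ₁ Σ₂ Σ₃} (f : SigHom Σ₁ Σ₂) (g : SigHom Σ₂ Σ₃) (ρ : Sen Σ₁) →
              Sen₁ (g ∘S f) ρ ≡ Sen₁ g (Sen₁ f ρ)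
    Mod     : SigObj → Category m mh
    Mod₁    : ∀ {Σ₁ Σ₂} → SigHom Σ₁ Σ₂ → Functor (Mod Σ₂) (Mod Σ₁)
    _⊨_     : ∀ {Σ₁} → Category.Obj (Mod Σ₁) → Sen Σ₁ → Set

  ModObj : SigObj → Set m
  ModObj Σ₁ = Category.Obj (Mod Σ₁)

  reduct : ∀ {Σ₁ Σ₂} → SigHom Σ₁ Σ₂ → ModObj Σ₂ → ModObj Σ₁
  reduct φ = Functor.F₀ (Mod₁ φ)

SatisfactionCondition : ∀ {o h s m mh} → PreInstitution o h s m mh → Set (o ⊔ h ⊔ s ⊔ m)
SatisfactionCondition P =
  ∀ {Σ₁ Σ₂} (φ : SigHom Σ₁ Σ₂) (M : ModObj Σ₂) (ρ : Sen Σ₁) →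
    (reduct φ M ⊨ ρ) ⇔ (M ⊨ Sen₁ φ ρ)
  where open PreInstitution P

record Institution (o h s m mh : Level) : Set (suc (o ⊔ h ⊔ s ⊔ m ⊔ mh)) where
  field
    pre : PreInstitution o h s m mh
    satisfaction : SatisfactionCondition pre
  open PreInstitution pre public

data LTL {s} (B : Set s) : Set s where
  base : B → LTL B
  ¬ₜ_  : LTL B → LTL B
  _∧ₜ_ : LTL B → LTL B → LTL B
  Xₜ_  : LTL B → LTL B
  _Uₜ_ : LTL B → LTL B → LTL B

mapLTL : ∀ {s t} {A : Set s} {B : Set t} → (A → B) → LTL A → LTL B
mapLTL f (base ψ) = base (f ψ)
mapLTL f (¬ₜ ρ) = ¬ₜ mapLTL f ρ
mapLTL f (ρ ∧ₜ ρ') = mapLTL f ρ ∧ₜ mapLTL f ρ'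
mapLTL f (Xₜ ρ) = Xₜ mapLTL f ρ
mapLTL f (ρ Uₜ ρ') = mapLTL f ρ Uₜ mapLTL f ρ'

Discrete : ∀ {m} → Set m → Category m m
Discrete A = record
  { Obj = A ; Hom = _≡_ ; idC = refl ; _∘C_ = λ g f → trans f g
  ; identityˡ = λ { refl → refl } ; identityʳ = λ { refl → refl }
  ; assoc = λ { refl refl refl → refl } }

-- Temporal models (ℕ, suc, m): since ℕ and suc are fixed, such a triple is
-- determined by its state map m : ℕ → |Mod^I(Σ)|.
record TModel {m} (A : Set m) : Set m where
  constructor tmodel
  field
    state : ℕ → A

module TemporalSat {s m} {B : Set s} {A : Set m} (_⊨ᴵ_ : A → B → Set) where
  _⊨^_∶_ : TModel A → ℕ → LTL B → Set
  M ⊨^ j ∶ base ψ   = TModel.state M j ⊨ᴵ ψ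
  M ⊨^ j ∶ (¬ₜ ρ)   = ¬ (M ⊨^ j ∶ ρ)
  M ⊨^ j ∶ (ρ ∧ₜ ρ') = (M ⊨^ j ∶ ρ) × (M ⊨^ j ∶ ρ')
  M ⊨^ j ∶ (Xₜ ρ)   = M ⊨^ sucℕ j ∶ ρ
  M ⊨^ j ∶ (ρ Uₜ ρ') = ∃ λ k → (j ≤ k) × (M ⊨^ k ∶ ρ') ×
                         (∀ i → j ≤ i → i < k → M ⊨^ i ∶ ρ)

mapLTL-id : ∀ {s} {A : Set s} (f : A → A) → (∀ x → f x ≡ x) → ∀ ρ → mapLTL f ρ ≡ ρ
mapLTL-id f e (base ψ) = cong base (e ψ)
mapLTL-id f e (¬ₜ ρ) = cong ¬ₜ_ (mapLTL-id f e ρ)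
mapLTL-id f e (ρ ∧ₜ ρ') rewrite mapLTL-id f e ρ | mapLTL-id f e ρ' = refl
mapLTL-id f e (Xₜ ρ) = cong Xₜ_ (mapLTL-id f e ρ)
mapLTL-id f e (ρ Uₜ ρ') rewrite mapLTL-id f e ρ | mapLTL-id f e ρ' = refl

mapLTL-∘ : ∀ {a b c} {A : Set a} {B : Set b} {C : Set c}
  (f : A → B) (g : B → C) (h : A → C) → (∀ x → h x ≡ g (f x)) →
  ∀ ρ → mapLTL h ρ ≡ mapLTL g (mapLTL f ρ)
mapLTL-∘ f g h e (base ψ) = cong base (e ψ)
mapLTL-∘ f g h e (¬ₜ ρ) = cong ¬ₜ_ (mapLTL-∘ f g h e ρ)
mapLTL-∘ f g h e (ρ ∧ₜ ρ') rewrite mapLTL-∘ f g h e ρ | mapLTL-∘ f g h e ρ' = refl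
mapLTL-∘ f g h e (Xₜ ρ) = cong Xₜ_ (mapLTL-∘ f g h e ρ)
mapLTL-∘ f g h e (ρ Uₜ ρ') rewrite mapLTL-∘ f g h e ρ | mapLTL-∘ f g h e ρ' = refl

Temporalisation : ∀ {o h s m mh} → Institution o h s m mh → PreInstitution o h s m m
Temporalisation {m = m} I = record
  { Sign = Sign
  ; Sen = λ Σ₁ → LTL (Sen Σ₁)
  ; Sen₁ = λ φ → mapLTL (Sen₁ φ)
  ; Sen-id = λ ρ → mapLTL-id _ Sen-id ρ
  ; Sen-∘ = λ f g ρ → mapLTL-∘ (Sen₁ f) (Sen₁ g) (Sen₁ (g ∘S f)) (Sen-∘ f g) ρ
  ; Mod = λ Σ₁ → Discrete (TModel (ModObj Σ₁))
  ; Mod₁ = λ φ → record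
      { F₀ = λ M → tmodel (reduct φ ∘ TModel.state M)
      ; F₁ = λ { refl → refl } ; F-id = refl ; F-∘ = λ { refl refl → refl } }
  ; _⊨_ = λ {Σ₁} M ρ → TemporalSat._⊨^_∶_ (_⊨_ {Σ₁}) M 0 ρ
  }
  where
    open Institution I

-- Satisfaction of an LTL sentence at instant j depends on the states only
-- through which base sentences they satisfy. The satisfaction condition of I
-- says that a state and its reduct agree on every base sentence up to
-- translation, so a structural induction on the sentence, carried out at all
-- instants simultaneously, lifts it to the temporalisation.
module Submission where

open import Defs
open import Data.Nat using (ℕ) renaming (suc to sucℕ)
open import Data.Product using (_,_)
open import Function using (_∘_)
open import Function.Bundles using (_⇔_; mk⇔; Equivalence)

module _ {s s′ m m′} {B : Set s} {B′ : Set s′} {A : Set m} {A′ : Set m′}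
         (_⊨_ : A → B → Set) (_⊨′_ : A′ → B′ → Set)
         (translate : B → B′) (reduce : A′ → A)
         (base-sat : ∀ a ψ → (reduce a ⊨ ψ) ⇔ (a ⊨′ translate ψ))
         (M : TModel A′) where

  open TemporalSat _⊨_ using (_⊨^_∶_)
  open TemporalSat _⊨′_ renaming (_⊨^_∶_ to _⊨′^_∶_)

  reducedModel : TModel A
  reducedModel = tmodel (reduce ∘ TModel.state M)

  mapLTL-sat⁺ : ∀ j ρ → reducedModel ⊨^ j ∶ ρ → M ⊨′^ j ∶ mapLTL translate ρ
  mapLTL-sat⁻ : ∀ j ρ → M ⊨′^ j ∶ mapLTL translate ρ → reducedModel ⊨^ j ∶ ρ

  mapLTL-sat⁺ j (base ψ) = Equivalence.to (base-sat (TModel.state M j) ψ)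
  mapLTL-sat⁺ j (¬ₜ ρ) ⊭ρ ⊨ρ = ⊭ρ (mapLTL-sat⁻ j ρ ⊨ρ)
  mapLTL-sat⁺ j (ρ ∧ₜ ρ′) (⊨ρ , ⊨ρ′) = mapLTL-sat⁺ j ρ ⊨ρ , mapLTL-sat⁺ j ρ′ ⊨ρ′
  mapLTL-sat⁺ j (Xₜ ρ) = mapLTL-sat⁺ (sucℕ j) ρ
  mapLTL-sat⁺ j (ρ Uₜ ρ′) (k , j≤k , ⊨ρ′ , until) =
    k , j≤k , mapLTL-sat⁺ k ρ′ ⊨ρ′ , λ i j≤i i<k → mapLTL-sat⁺ i ρ (until i j≤i i<k)

  mapLTL-sat⁻ j (base ψ) = Equivalence.from (base-sat (TModel.state M j) ψ)
  mapLTL-sat⁻ j (¬ₜ ρ) ⊭ρ ⊨ρ = ⊭ρ (mapLTL-sat⁺ j ρ ⊨ρ)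
  mapLTL-sat⁻ j (ρ ∧ₜ ρ′) (⊨ρ , ⊨ρ′) = mapLTL-sat⁻ j ρ ⊨ρ , mapLTL-sat⁻ j ρ′ ⊨ρ′
  mapLTL-sat⁻ j (Xₜ ρ) = mapLTL-sat⁻ (sucℕ j) ρ
  mapLTL-sat⁻ j (ρ Uₜ ρ′) (k , j≤k , ⊨ρ′ , until) =
    k , j≤k , mapLTL-sat⁻ k ρ′ ⊨ρ′ , λ i j≤i i<k → mapLTL-sat⁻ i ρ (until i j≤i i<k)

  mapLTL-sat : ∀ j ρ → (reducedModel ⊨^ j ∶ ρ) ⇔ (M ⊨′^ j ∶ mapLTL translate ρ)
  mapLTL-sat j ρ = mk⇔ (mapLTL-sat⁺ j ρ) (mapLTL-sat⁻ j ρ)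

theorem1 : ∀ {o h s m mh} (I : Institution o h s m mh) →
    SatisfactionCondition (Temporalisation I)
theorem1 I φ M ρ =
  mapLTL-sat _⊨_ _⊨_ (Sen₁ φ) (reduct φ) (satisfaction φ) M 0 ρ
  where open Institution I
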